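{- For every $\gamma,\xi>0$ there is $\nu\in(0,\tfrac12)$ such that the following holds. Let $g\colon(\{0,1\}^n,\mu_\nu)\to\{0,1\}$ satisfy $\mathbb{E}_{\mathbf{y}\sim\mu_\nu}[g(\mathbf{y})]\ge\gamma\nu^{3/4}$. Then $\Pr_{\mathbf{x}\sim\mu_{1/2}}\big[\mathrm{T}^{\uparrow}g(\mathbf{x})\ge\nu\big]\ge1-\xi$.
   Context: $\mu_q$ is the $q$-biased product measure on $\{0,1\}^n$. For $q\le r$, $\mathbb{D}(q,r)$ is the distribution on pairs $(\mathbf{u},\mathbf{v})\in\{0,1\}^n\times\{0,1\}^n$ in which independently for each $i$, $\Pr[\mathbf{u}_i=1]=q$, $\Pr[\mathbf{v}_i=1]=r$, and always $\mathbf{u}_i\le\mathbf{v}_i$. For $g$ on $(\{0,1\}^n,\mu_\nu)$ define $\mathrm{T}^{\uparrow}g(a)=\mathbb{E}_{(\mathbf{u},\mathbf{v})\sim\mathbb{D}(\nu,1/2)}[g(\mathbf{u})\mid\mathbf{v}=a]$ for $a\in\{0,1\}^n$ (equivalently $\mathbb{E}_{\mathbf{z}\sim\mu_{2\nu}}[g(a\wedge\mathbf{z})]$).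
   Formalization: The parameters γ and ξ range over the positive rationals, and the value ν is taken in ℚ. -}

module Defs where

open import Data.Bool using (Bool; true; false; _∧_; if_then_else_)
open import Data.Nat using (ℕ; zero; suc)
open import Data.Vec using (Vec; []; _∷_; zipWith)
open import Data.Rational using (ℚ; 0ℚ; 1ℚ; ½; _+_; _*_; _-_; _≤_)
open import Data.Rational.Properties using (_≤?_)
open import Relation.Nullary.Decidable using (does)

Cube : ℕ → Set
Cube n = Vec Bool n

sumCube : (n : ℕ) → (Cube n → ℚ) → ℚ
sumCube zero    f = f []
sumCube (suc n) f = sumCube n (λ v → f (true ∷ v)) + sumCube n (λ v → f (false ∷ v))

μ : (p : ℚ) → {n : ℕ} → Cube n → ℚ
μ p []          = 1ℚ
μ p (true ∷ x)  = p * μ p x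
μ p (false ∷ x) = (1ℚ - p) * μ p x

𝔼 : (p : ℚ) → (n : ℕ) → (Cube n → ℚ) → ℚ
𝔼 p n f = sumCube n (λ x → μ p x * f x)

𝟙 : Bool → ℚ
𝟙 b = if b then 1ℚ else 0ℚ

Pr : (p : ℚ) → (n : ℕ) → (Cube n → Bool) → ℚ
Pr p n A = 𝔼 p n (λ x → 𝟙 (A x))

_⊓_ : {n : ℕ} → Cube n → Cube n → Cube n
_⊓_ = zipWith _∧_

-- T↑ g (a) = E_{z ~ μ_{2ν}} [ g (a ∧ z) ]  (equivalent form of the D(ν,1/2) conditional expectation)
T↑ : (ν : ℚ) → (n : ℕ) → (Cube n → Bool) → Cube n → ℚ
T↑ ν n g a = 𝔼 (ν + ν) n (λ z → 𝟙 (g (a ⊓ z)))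

_≤ᵇ_ : ℚ → ℚ → Bool
x ≤ᵇ y = does (x ≤? y)

-- "γ · ν^{3/4} ≤ e" for γ ≥ 0, ν > 0, e ≥ 0, rendered without fractional powers:
-- equivalent to γ⁴ · ν³ ≤ e⁴ together with 0 ≤ e.
AtLeastγν¾ : (γ ν e : ℚ) → Set
AtLeastγν¾ γ ν e = (0ℚ ≤ e) × ((γ * γ * γ * γ) * (ν * ν * ν) ≤ e * e * e * e)
  where open import Data.Product using (_×_)

-- Let Down ρ F (a) = 𝔼_{z ∼ μ_ρ} F (a ⊓ z), so that T↑ ν g = Down (2ν) (𝟙 ∘ g). If x ∼ μ_p then
-- x ⊓ z ∼ μ_{pρ}, so Down turns μ_{pρ}-means into μ_p-means, and splitting off one coordinate at a
-- time (the slack of each step is a variance of F₁ − F₀) shows that it contracts variance: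
-- (1 − pρ) Var_p (Down ρ F) ≤ ρ (1 − p) Var_{pρ} F. For p = ½, ρ = 2ν and g of μ_ν-mean m this gives
-- (1 − ν) Var (T↑ g) ≤ ν m, and Chebyshev around the mean m ≥ 2ν bounds Pr [T↑ g < ν] by 8ν / m.
-- Choosing ν = t⁴ turns m ≥ γ ν^{3/4} into m ≥ γ t³, so 8ν / m ≤ 8t / γ ≤ ξ for small t.

module Submission where

open import Defs
open import Agda.Builtin.FromNat using (Number; fromNat)
open import Algebra.Bundles using (CommutativeMonoid)
open import Data.Bool using (Bool; true; false)
open import Data.List using (List; _∷_; [])
open import Data.Nat using (ℕ; zero; suc)
open import Data.Product using (Σ; _×_; _,_)
open import Data.Rational using (ℚ; 0ℚ; 1ℚ; ½; _+_; _*_; _-_; -_; _<_; _≤_; positive; nonNegative)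
import Data.Rational as ℚ
open import Data.Rational.Literals using (number)
open import Data.Rational.Properties
open import Data.Sum using (inj₁; inj₂)
open import Data.Unit using (tt)
open import Data.Vec using ([]; _∷_)
open import Function using (_∘_; _∋_)
open import Level using (0ℓ)
open import Relation.Binary.PropositionalEquality
open import Relation.Nullary using (Dec; yes; no; does; ¬_)
open import Relation.Nullary.Decidable using (dec⇒maybe; toWitness)
open import Tactic.RingSolver using (solve; solve-∀)
open import Tactic.RingSolver.Core.AlmostCommutativeRing using (AlmostCommutativeRing; fromCommutativeRing)
open import Algebra.Properties.CommutativeSemigroup (CommutativeMonoid.commutativeSemigroup +-0-commutativeMonoid)
  using () renaming (interchange to +-interchange)
open import Algebra.Properties.CommutativeSemigroup (CommutativeMonoid.commutativeSemigroup *-1-commutativeMonoid)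
  using () renaming (x∙yz≈y∙xz to *-left-commute)

-- Vec's _∷_ is also in scope, so variable lists for the ring solver are written List ℚ ∋ ….
ℚ-ring : AlmostCommutativeRing 0ℓ 0ℓ
ℚ-ring = fromCommutativeRing +-*-commutativeRing (λ x → dec⇒maybe (0ℚ ≟ x))

-- For the ℚ literals 2, 6 and 8; literal overloading also needs the imported fromNat in scope.
instance
  ℚ-number : Number ℚ
  ℚ-number = number

p≤q⇒0≤q-p : ∀ {p q} → p ≤ q → 0ℚ ≤ q - p
p≤q⇒0≤q-p {p} {q} p≤q = subst (_≤ q - p) (+-inverseʳ p) (+-monoˡ-≤ (- p) p≤q)

p<q⇒0<q-p : ∀ {p q} → p < q → 0ℚ < q - p
p<q⇒0<q-p {p} {q} p<q = subst (_< q - p) (+-inverseʳ p) (+-monoˡ-< (- p) p<q)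

0≤q-p⇒p≤q : ∀ {p q} → 0ℚ ≤ q - p → p ≤ q
0≤q-p⇒p≤q {p} {q} 0≤q-p = begin
  p          ≡⟨ sym (+-identityˡ p) ⟩
  0ℚ + p     ≤⟨ +-monoˡ-≤ p 0≤q-p ⟩
  q - p + p  ≡⟨ solve (List ℚ ∋ p ∷ q ∷ []) ℚ-ring ⟩
  q          ∎
  where open ≤-Reasoning

≤-by-difference : ∀ {p q} r → q - p ≡ r → 0ℚ ≤ r → p ≤ q
≤-by-difference r q-p≡r 0≤r = 0≤q-p⇒p≤q (subst (0ℚ ≤_) (sym q-p≡r) 0≤r)

+-nonNeg : ∀ {p q} → 0ℚ ≤ p → 0ℚ ≤ q → 0ℚ ≤ p + q
+-nonNeg = +-mono-≤

*-nonNeg : ∀ {p q} → 0ℚ ≤ p → 0ℚ ≤ q → 0ℚ ≤ p * q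
*-nonNeg {p} {q} 0≤p 0≤q =
  nonNegative⁻¹ (p * q) {{nonNeg*nonNeg⇒nonNeg p {{nonNegative 0≤p}} q {{nonNegative 0≤q}}}}

*-pos : ∀ {p q} → 0ℚ < p → 0ℚ < q → 0ℚ < p * q
*-pos {p} {q} 0<p 0<q = positive⁻¹ (p * q) {{pos*pos⇒pos p {{positive 0<p}} q {{positive 0<q}}}}

square-nonNeg : ∀ p → 0ℚ ≤ p * p
square-nonNeg p with ≤-total 0ℚ p
... | inj₁ 0≤p = *-nonNeg 0≤p 0≤p
... | inj₂ p≤0 = begin
  0ℚ         ≤⟨ *-nonNeg 0≤-p 0≤-p ⟩
  - p * - p  ≡⟨ solve (List ℚ ∋ p ∷ []) ℚ-ring ⟩
  p * p      ∎
  where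
  open ≤-Reasoning
  0≤-p : 0ℚ ≤ - p
  0≤-p = neg-antimono-≤ p≤0

*-mono-≤-nonNeg : ∀ {p q r s} → 0ℚ ≤ p → p ≤ q → 0ℚ ≤ r → r ≤ s → p * r ≤ q * s
*-mono-≤-nonNeg {p} {q} {r} {s} 0≤p p≤q 0≤r r≤s = begin
  p * r  ≤⟨ *-monoʳ-≤-nonNeg r {{nonNegative 0≤r}} p≤q ⟩
  q * r  ≤⟨ *-monoˡ-≤-nonNeg q {{nonNegative (≤-trans 0≤p p≤q)}} r≤s ⟩
  q * s  ∎
  where open ≤-Reasoning

convex-mono-≤ : ∀ {p a a′ b b′} → 0ℚ ≤ p → p ≤ 1ℚ → a ≤ a′ → b ≤ b′ →
  p * a + (1ℚ - p) * b ≤ p * a′ + (1ℚ - p) * b′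
convex-mono-≤ {p} 0≤p p≤1 a≤a′ b≤b′ = +-mono-≤
  (*-monoˡ-≤-nonNeg p {{nonNegative 0≤p}} a≤a′)
  (*-monoˡ-≤-nonNeg (1ℚ - p) {{nonNegative (p≤q⇒0≤q-p p≤1)}} b≤b′)

convex-square-≤ : ∀ {p x y a b} → 0ℚ ≤ p → p ≤ 1ℚ → x * x ≤ a → y * y ≤ b →
  (p * x + (1ℚ - p) * y) * (p * x + (1ℚ - p) * y) ≤ p * a + (1ℚ - p) * b
convex-square-≤ {p} {x} {y} {a} {b} 0≤p p≤1 xx≤a yy≤b =
  ≤-by-difference (p * (1ℚ - p) * ((x - y) * (x - y)) + (p * (a - x * x) + (1ℚ - p) * (b - y * y)))
    (solve (List ℚ ∋ p ∷ x ∷ y ∷ a ∷ b ∷ []) ℚ-ring)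
    (+-nonNeg (*-nonNeg (*-nonNeg 0≤p 0≤1-p) (square-nonNeg (x - y)))
              (+-nonNeg (*-nonNeg 0≤p (p≤q⇒0≤q-p xx≤a)) (*-nonNeg 0≤1-p (p≤q⇒0≤q-p yy≤b))))
  where
  0≤1-p : 0ℚ ≤ 1ℚ - p
  0≤1-p = p≤q⇒0≤q-p p≤1

square-cancel-≤ : ∀ {p q} → 0ℚ ≤ q → p * p ≤ q * q → p ≤ q
square-cancel-≤ {p} {q} 0≤q pp≤qq = ≮⇒≥ q≮p
  where
  q≮p : ¬ (q < p)
  q≮p q<p = <-irrefl refl (<-≤-trans qq<pp pp≤qq)
    where
    open ≤-Reasoning
    qq<pp : q * q < p * p
    qq<pp = begin-strict
      q * q  ≤⟨ *-monoˡ-≤-nonNeg q {{nonNegative 0≤q}} (<⇒≤ q<p) ⟩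
      q * p  <⟨ *-monoˡ-<-pos p {{positive (≤-<-trans 0≤q q<p)}} q<p ⟩
      p * p  ∎

⁴-mono-≤ : ∀ {p q} → 0ℚ ≤ p → p ≤ q → p * p * p * p ≤ q * q * q * q
⁴-mono-≤ 0≤p p≤q = *-mono-≤-nonNeg (*-nonNeg (*-nonNeg 0≤p 0≤p) 0≤p)
  (*-mono-≤-nonNeg (*-nonNeg 0≤p 0≤p) (*-mono-≤-nonNeg 0≤p p≤q 0≤p p≤q) 0≤p p≤q) 0≤p p≤q

⁴-cancel-≤ : ∀ {p q} → 0ℚ ≤ q → p * p * p * p ≤ q * q * q * q → p ≤ q
⁴-cancel-≤ {p} {q} 0≤q p⁴≤q⁴ = square-cancel-≤ 0≤q (square-cancel-≤ (square-nonNeg q) (begin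
  (p * p) * (p * p)  ≡⟨ solve (List ℚ ∋ p ∷ []) ℚ-ring ⟩
  p * p * p * p      ≤⟨ p⁴≤q⁴ ⟩
  q * q * q * q      ≡⟨ solve (List ℚ ∋ q ∷ []) ℚ-ring ⟩
  (q * q) * (q * q)  ∎))
  where open ≤-Reasoning

convex-self : ∀ p a → p * a + (1ℚ - p) * a ≡ a
convex-self = solve-∀ ℚ-ring

sumCube-cong : ∀ n {f g : Cube n → ℚ} → f ≗ g → sumCube n f ≡ sumCube n g
sumCube-cong zero    f≗g = f≗g []
sumCube-cong (suc n) f≗g =
  cong₂ _+_ (sumCube-cong n (f≗g ∘ (true ∷_))) (sumCube-cong n (f≗g ∘ (false ∷_)))

sumCube-+ : ∀ n (f g : Cube n → ℚ) → sumCube n (λ x → f x + g x) ≡ sumCube n f + sumCube n g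
sumCube-+ zero    f g = refl
sumCube-+ (suc n) f g = trans
  (cong₂ _+_ (sumCube-+ n (f ∘ (true ∷_)) (g ∘ (true ∷_)))
             (sumCube-+ n (f ∘ (false ∷_)) (g ∘ (false ∷_))))
  (+-interchange (sumCube n (f ∘ (true ∷_))) (sumCube n (g ∘ (true ∷_)))
                 (sumCube n (f ∘ (false ∷_))) (sumCube n (g ∘ (false ∷_))))

sumCube-*ˡ : ∀ n c (f : Cube n → ℚ) → sumCube n (λ x → c * f x) ≡ c * sumCube n f
sumCube-*ˡ zero    c f = refl
sumCube-*ˡ (suc n) c f = trans
  (cong₂ _+_ (sumCube-*ˡ n c (f ∘ (true ∷_))) (sumCube-*ˡ n c (f ∘ (false ∷_))))
  (sym (*-distribˡ-+ c (sumCube n (f ∘ (true ∷_))) (sumCube n (f ∘ (false ∷_)))))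

sumCube-neg : ∀ n (f : Cube n → ℚ) → sumCube n (λ x → - f x) ≡ - sumCube n f
sumCube-neg zero    f = refl
sumCube-neg (suc n) f = trans
  (cong₂ _+_ (sumCube-neg n (f ∘ (true ∷_))) (sumCube-neg n (f ∘ (false ∷_))))
  (sym (neg-distrib-+ (sumCube n (f ∘ (true ∷_))) (sumCube n (f ∘ (false ∷_)))))

module _ (p : ℚ) (n : ℕ) where

  𝔼-cong : {f g : Cube n → ℚ} → f ≗ g → 𝔼 p n f ≡ 𝔼 p n g
  𝔼-cong f≗g = sumCube-cong n (λ x → cong (μ p x *_) (f≗g x))

  𝔼-+ : (f g : Cube n → ℚ) → 𝔼 p n (λ x → f x + g x) ≡ 𝔼 p n f + 𝔼 p n g
  𝔼-+ f g = trans (sumCube-cong n (λ x → *-distribˡ-+ (μ p x) (f x) (g x))) (sumCube-+ n _ _)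

  𝔼-*ˡ : ∀ c (f : Cube n → ℚ) → 𝔼 p n (λ x → c * f x) ≡ c * 𝔼 p n f
  𝔼-*ˡ c f = trans (sumCube-cong n (λ x → *-left-commute (μ p x) c (f x))) (sumCube-*ˡ n c _)

  𝔼-- : (f g : Cube n → ℚ) → 𝔼 p n (λ x → f x - g x) ≡ 𝔼 p n f - 𝔼 p n g
  𝔼-- f g = trans (𝔼-+ f (λ x → - g x)) (cong (𝔼 p n f +_)
    (trans (sumCube-cong n (λ x → sym (neg-distribʳ-* (μ p x) (g x)))) (sumCube-neg n _)))

  𝔼-linear : ∀ a b (f g : Cube n → ℚ) →
    𝔼 p n (λ x → a * f x + b * g x) ≡ a * 𝔼 p n f + b * 𝔼 p n g
  𝔼-linear a b f g = trans (𝔼-+ _ _) (cong₂ _+_ (𝔼-*ˡ a f) (𝔼-*ˡ b g))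

𝔼-suc : ∀ p n (f : Cube (suc n) → ℚ) →
  𝔼 p (suc n) f ≡ p * 𝔼 p n (f ∘ (true ∷_)) + (1ℚ - p) * 𝔼 p n (f ∘ (false ∷_))
𝔼-suc p n f = cong₂ _+_
  (trans (sumCube-cong n (λ v → *-assoc p (μ p v) (f (true ∷ v)))) (sumCube-*ˡ n p _))
  (trans (sumCube-cong n (λ v → *-assoc (1ℚ - p) (μ p v) (f (false ∷ v))))
         (sumCube-*ˡ n (1ℚ - p) _))

𝔼-const : ∀ p n c → 𝔼 p n (λ _ → c) ≡ c
𝔼-const p zero    c = *-identityˡ c
𝔼-const p (suc n) c = begin
  𝔼 p (suc n) (λ _ → c)
    ≡⟨ 𝔼-suc p n (λ _ → c) ⟩
  p * 𝔼 p n (λ _ → c) + (1ℚ - p) * 𝔼 p n (λ _ → c)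
    ≡⟨ cong (λ e → p * e + (1ℚ - p) * e) (𝔼-const p n c) ⟩
  p * c + (1ℚ - p) * c
    ≡⟨ convex-self p c ⟩
  c ∎
  where open ≡-Reasoning

module _ {p : ℚ} (0≤p : 0ℚ ≤ p) (p≤1 : p ≤ 1ℚ) where

  𝔼-mono : ∀ n {f g : Cube n → ℚ} → (∀ x → f x ≤ g x) → 𝔼 p n f ≤ 𝔼 p n g
  𝔼-mono zero    f≤g = *-monoˡ-≤-nonNeg 1ℚ (f≤g [])
  𝔼-mono (suc n) {f} {g} f≤g = begin
    𝔼 p (suc n) f  ≡⟨ 𝔼-suc p n f ⟩
    _              ≤⟨ convex-mono-≤ 0≤p p≤1 (𝔼-mono n (f≤g ∘ (true ∷_)))
                                           (𝔼-mono n (f≤g ∘ (false ∷_))) ⟩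
    _              ≡⟨ sym (𝔼-suc p n g) ⟩
    𝔼 p (suc n) g  ∎
    where open ≤-Reasoning

  𝔼-square-≤ : ∀ n (f : Cube n → ℚ) → 𝔼 p n f * 𝔼 p n f ≤ 𝔼 p n (λ x → f x * f x)
  𝔼-square-≤ zero    f = ≤-reflexive
    (trans (cong₂ _*_ (*-identityˡ (f [])) (*-identityˡ (f []))) (sym (*-identityˡ (f [] * f []))))
  𝔼-square-≤ (suc n) f = begin
    𝔼 p (suc n) f * 𝔼 p (suc n) f  ≡⟨ cong (λ e → e * e) (𝔼-suc p n f) ⟩
    _                              ≤⟨ convex-square-≤ 0≤p p≤1 (𝔼-square-≤ n (f ∘ (true ∷_)))
                                                               (𝔼-square-≤ n (f ∘ (false ∷_))) ⟩
    _                              ≡⟨ sym (𝔼-suc p n (λ x → f x * f x)) ⟩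
    𝔼 p (suc n) (λ x → f x * f x)  ∎
    where open ≤-Reasoning

Var : (p : ℚ) (n : ℕ) → (Cube n → ℚ) → ℚ
Var p n f = 𝔼 p n (λ x → (f x - 𝔼 p n f) * (f x - 𝔼 p n f))

Var-≡ : ∀ p n (f : Cube n → ℚ) → Var p n f ≡ 𝔼 p n (λ x → f x * f x) - 𝔼 p n f * 𝔼 p n f
Var-≡ p n f = begin
  Var p n f
    ≡⟨ 𝔼-cong p n (λ x → expand (f x) m) ⟩
  𝔼 p n (λ x → (f x * f x - (m + m) * f x) + m * m)
    ≡⟨ 𝔼-+ p n _ _ ⟩
  𝔼 p n (λ x → f x * f x - (m + m) * f x) + 𝔼 p n (λ _ → m * m)
    ≡⟨ cong₂ _+_ (trans (𝔼-- p n _ _) (cong (_-_ (𝔼 p n (λ x → f x * f x))) (𝔼-*ˡ p n (m + m) f)))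
                 (𝔼-const p n (m * m)) ⟩
  𝔼 p n (λ x → f x * f x) - (m + m) * m + m * m
    ≡⟨ collect (𝔼 p n (λ x → f x * f x)) m ⟩
  𝔼 p n (λ x → f x * f x) - m * m
    ∎
  where
  open ≡-Reasoning
  m = 𝔼 p n f
  expand : ∀ y m → (y - m) * (y - m) ≡ (y * y - (m + m) * y) + m * m
  expand = solve-∀ ℚ-ring
  collect : ∀ s m → s - (m + m) * m + m * m ≡ s - m * m
  collect = solve-∀ ℚ-ring

below-threshold-≤ : ∀ {ν m} y → ν ≤ m →
  (m - ν) * (m - ν) * (1ℚ - 𝟙 (ν ≤ᵇ y)) ≤ (y - m) * (y - m)
below-threshold-≤ {ν} {m} y ν≤m = by-cases (ν ≤? y)
  where
  open ≤-Reasoning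
  by-cases : (ν≤?y : Dec (ν ≤ y)) →
    (m - ν) * (m - ν) * (1ℚ - 𝟙 (does ν≤?y)) ≤ (y - m) * (y - m)
  by-cases (yes _) = begin
    (m - ν) * (m - ν) * (1ℚ - 1ℚ)  ≡⟨ *-zeroʳ ((m - ν) * (m - ν)) ⟩
    0ℚ                             ≤⟨ square-nonNeg (y - m) ⟩
    (y - m) * (y - m)              ∎
  by-cases (no ν≰y) = begin
    (m - ν) * (m - ν) * (1ℚ - 0ℚ)  ≡⟨ *-identityʳ ((m - ν) * (m - ν)) ⟩
    (m - ν) * (m - ν)              ≤⟨ *-mono-≤-nonNeg 0≤m-ν m-ν≤m-y 0≤m-ν m-ν≤m-y ⟩
    (m - y) * (m - y)              ≡⟨ solve (List ℚ ∋ y ∷ m ∷ []) ℚ-ring ⟩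
    (y - m) * (y - m)              ∎
    where
    0≤m-ν : 0ℚ ≤ m - ν
    0≤m-ν = p≤q⇒0≤q-p ν≤m
    m-ν≤m-y : m - ν ≤ m - y
    m-ν≤m-y = +-monoʳ-≤ m (neg-antimono-≤ (<⇒≤ (≰⇒> ν≰y)))

chebyshev : ∀ {p} → 0ℚ ≤ p → p ≤ 1ℚ → ∀ n (f : Cube n → ℚ) {ν} → ν ≤ 𝔼 p n f →
  (𝔼 p n f - ν) * (𝔼 p n f - ν) * (1ℚ - Pr p n (λ x → ν ≤ᵇ f x)) ≤ Var p n f
chebyshev {p} 0≤p p≤1 n f {ν} ν≤m = begin
  K * (1ℚ - Pr p n (λ x → ν ≤ᵇ f x))
    ≡⟨ cong (λ e → K * (e - Pr p n (λ x → ν ≤ᵇ f x))) (sym (𝔼-const p n 1ℚ)) ⟩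
  K * (𝔼 p n (λ _ → 1ℚ) - Pr p n (λ x → ν ≤ᵇ f x))
    ≡⟨ cong (K *_) (sym (𝔼-- p n _ _)) ⟩
  K * 𝔼 p n (λ x → 1ℚ - 𝟙 (ν ≤ᵇ f x))
    ≡⟨ sym (𝔼-*ˡ p n K _) ⟩
  𝔼 p n (λ x → K * (1ℚ - 𝟙 (ν ≤ᵇ f x)))
    ≤⟨ 𝔼-mono 0≤p p≤1 n (λ x → below-threshold-≤ (f x) ν≤m) ⟩
  Var p n f
    ∎
  where
  open ≤-Reasoning
  K = (𝔼 p n f - ν) * (𝔼 p n f - ν)

-- T↑ ν n g is definitionally Down (ν + ν) n (𝟙 ∘ g).
Down : (ρ : ℚ) (n : ℕ) → (Cube n → ℚ) → Cube n → ℚ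
Down ρ n F a = 𝔼 ρ n (λ z → F (a ⊓ z))

module _ (ρ : ℚ) (n : ℕ) (F : Cube (suc n) → ℚ) where

  Down-true : ∀ x →
    Down ρ (suc n) F (true ∷ x) ≡ Down ρ n (λ v → ρ * F (true ∷ v) + (1ℚ - ρ) * F (false ∷ v)) x
  Down-true x = trans (𝔼-suc ρ n (λ z → F ((true ∷ x) ⊓ z)))
    (sym (𝔼-linear ρ n ρ (1ℚ - ρ) (λ z → F (true ∷ (x ⊓ z))) (λ z → F (false ∷ (x ⊓ z)))))

  Down-false : ∀ x → Down ρ (suc n) F (false ∷ x) ≡ Down ρ n (F ∘ (false ∷_)) x
  Down-false x = trans (𝔼-suc ρ n (λ z → F ((false ∷ x) ⊓ z)))
    (convex-self ρ (Down ρ n (F ∘ (false ∷_)) x))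

𝔼-Down : ∀ p ρ n (F : Cube n → ℚ) → 𝔼 p n (Down ρ n F) ≡ 𝔼 (p * ρ) n F
𝔼-Down p ρ zero    F = cong (1ℚ *_) (*-identityˡ (F []))
𝔼-Down p ρ (suc n) F = begin
  𝔼 p (suc n) (Down ρ (suc n) F)
    ≡⟨ 𝔼-suc p n (Down ρ (suc n) F) ⟩
  p * 𝔼 p n (Down ρ (suc n) F ∘ (true ∷_)) + (1ℚ - p) * 𝔼 p n (Down ρ (suc n) F ∘ (false ∷_))
    ≡⟨ cong₂ (λ a b → p * a + (1ℚ - p) * b)
         (trans (𝔼-cong p n (Down-true ρ n F)) (𝔼-Down p ρ n H))
         (trans (𝔼-cong p n (Down-false ρ n F)) (𝔼-Down p ρ n F₀)) ⟩
  p * 𝔼 q n H + (1ℚ - p) * 𝔼 q n F₀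
    ≡⟨ cong (λ a → p * a + (1ℚ - p) * 𝔼 q n F₀) (𝔼-linear q n ρ (1ℚ - ρ) F₁ F₀) ⟩
  p * (ρ * 𝔼 q n F₁ + (1ℚ - ρ) * 𝔼 q n F₀) + (1ℚ - p) * 𝔼 q n F₀
    ≡⟨ regroup p ρ (𝔼 q n F₁) (𝔼 q n F₀) ⟩
  q * 𝔼 q n F₁ + (1ℚ - q) * 𝔼 q n F₀
    ≡⟨ sym (𝔼-suc q n F) ⟩
  𝔼 q (suc n) F
    ∎
  where
  open ≡-Reasoning
  q = p * ρ
  F₁ F₀ H : Cube n → ℚ
  F₁ = F ∘ (true ∷_)
  F₀ = F ∘ (false ∷_)
  H = λ v → ρ * F₁ v + (1ℚ - ρ) * F₀ v
  regroup : ∀ p ρ a b →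
    p * (ρ * a + (1ℚ - ρ) * b) + (1ℚ - p) * b ≡ p * ρ * a + (1ℚ - p * ρ) * b
  regroup = solve-∀ ℚ-ring

module _ (p : ℚ) (n : ℕ) (f g : Cube n → ℚ) where

  𝔼-square-linear : ∀ s t →
    𝔼 p n (λ y → (s * f y + t * g y) * (s * f y + t * g y))
      ≡ s * s * 𝔼 p n (λ y → f y * f y) + (s + s) * t * 𝔼 p n (λ y → f y * g y)
        + t * t * 𝔼 p n (λ y → g y * g y)
  𝔼-square-linear s t = begin
    𝔼 p n (λ y → (s * f y + t * g y) * (s * f y + t * g y))
      ≡⟨ 𝔼-cong p n (λ y → expand s t (f y) (g y)) ⟩
    𝔼 p n (λ y → (s * s * (f y * f y) + (s + s) * t * (f y * g y)) + t * t * (g y * g y))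
      ≡⟨ 𝔼-+ p n _ _ ⟩
    𝔼 p n (λ y → s * s * (f y * f y) + (s + s) * t * (f y * g y))
      + 𝔼 p n (λ y → t * t * (g y * g y))
      ≡⟨ cong₂ _+_ (𝔼-linear p n (s * s) ((s + s) * t) _ _) (𝔼-*ˡ p n (t * t) _) ⟩
    s * s * 𝔼 p n (λ y → f y * f y) + (s + s) * t * 𝔼 p n (λ y → f y * g y)
      + t * t * 𝔼 p n (λ y → g y * g y)
      ∎
    where
    open ≡-Reasoning
    expand : ∀ s t a b →
      (s * a + t * b) * (s * a + t * b) ≡ (s * s * (a * a) + (s + s) * t * (a * b)) + t * t * (b * b)
    expand = solve-∀ ℚ-ring

  𝔼-square-difference :
    𝔼 p n (λ y → (f y - g y) * (f y - g y))
      ≡ 𝔼 p n (λ y → f y * f y) - (𝔼 p n (λ y → f y * g y) + 𝔼 p n (λ y → f y * g y))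
        + 𝔼 p n (λ y → g y * g y)
  𝔼-square-difference = begin
    𝔼 p n (λ y → (f y - g y) * (f y - g y))
      ≡⟨ 𝔼-cong p n (λ y → expand (f y) (g y)) ⟩
    𝔼 p n (λ y → (f y * f y - (f y * g y + f y * g y)) + g y * g y)
      ≡⟨ 𝔼-+ p n _ _ ⟩
    𝔼 p n (λ y → f y * f y - (f y * g y + f y * g y)) + 𝔼 p n (λ y → g y * g y)
      ≡⟨ cong (_+ 𝔼 p n (λ y → g y * g y))
           (trans (𝔼-- p n _ _) (cong (_-_ (𝔼 p n (λ y → f y * f y))) (𝔼-+ p n _ _))) ⟩
    𝔼 p n (λ y → f y * f y) - (𝔼 p n (λ y → f y * g y) + 𝔼 p n (λ y → f y * g y))
      + 𝔼 p n (λ y → g y * g y)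
      ∎
    where
    open ≡-Reasoning
    expand : ∀ a b → (a - b) * (a - b) ≡ (a * a - (a * b + a * b)) + b * b
    expand = solve-∀ ℚ-ring

-- One coordinate of Down-second-moment: sH and s₀ are the μ_p second moments of Down on the two
-- halves of the cube, a, b, c the μ_{pρ} means of F₁², F₀², F₁F₀ and m₁, m₀ those of F₁, F₀.
second-moment-step : ∀ {p ρ sH s₀ a b c m₁ m₀} → 0ℚ ≤ p → p ≤ 1ℚ → ρ ≤ 1ℚ →
  (1ℚ - p * ρ) * sH
    ≤ ρ * (1ℚ - p) * (ρ * ρ * a + (ρ + ρ) * (1ℚ - ρ) * c + (1ℚ - ρ) * (1ℚ - ρ) * b)
      + (1ℚ - ρ) * ((ρ * m₁ + (1ℚ - ρ) * m₀) * (ρ * m₁ + (1ℚ - ρ) * m₀)) →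
  (1ℚ - p * ρ) * s₀ ≤ ρ * (1ℚ - p) * b + (1ℚ - ρ) * (m₀ * m₀) →
  (m₁ - m₀) * (m₁ - m₀) ≤ a - (c + c) + b →
  (1ℚ - p * ρ) * (p * sH + (1ℚ - p) * s₀)
    ≤ ρ * (1ℚ - p) * (p * ρ * a + (1ℚ - p * ρ) * b)
      + (1ℚ - ρ) * ((p * ρ * m₁ + (1ℚ - p * ρ) * m₀) * (p * ρ * m₁ + (1ℚ - p * ρ) * m₀))
second-moment-step {p} {ρ} {sH} {s₀} {a} {b} {c} {m₁} {m₀} 0≤p p≤1 ρ≤1 hH h₀ jensen = begin
  (1ℚ - p * ρ) * (p * sH + (1ℚ - p) * s₀)
    ≡⟨ solve (List ℚ ∋ p ∷ ρ ∷ sH ∷ s₀ ∷ []) ℚ-ring ⟩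
  p * ((1ℚ - p * ρ) * sH) + (1ℚ - p) * ((1ℚ - p * ρ) * s₀)
    ≤⟨ convex-mono-≤ 0≤p p≤1 hH h₀ ⟩
  p * (ρ * (1ℚ - p) * (ρ * ρ * a + (ρ + ρ) * (1ℚ - ρ) * c + (1ℚ - ρ) * (1ℚ - ρ) * b)
       + (1ℚ - ρ) * ((ρ * m₁ + (1ℚ - ρ) * m₀) * (ρ * m₁ + (1ℚ - ρ) * m₀)))
    + (1ℚ - p) * (ρ * (1ℚ - p) * b + (1ℚ - ρ) * (m₀ * m₀))
    ≤⟨ ≤-by-difference (ρ * ρ * (p * (1ℚ - p)) * (1ℚ - ρ) * ((a - (c + c) + b) - (m₁ - m₀) * (m₁ - m₀)))
         (solve (List ℚ ∋ p ∷ ρ ∷ a ∷ b ∷ c ∷ m₁ ∷ m₀ ∷ []) ℚ-ring)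
         (*-nonNeg (*-nonNeg (*-nonNeg (square-nonNeg ρ) (*-nonNeg 0≤p (p≤q⇒0≤q-p p≤1)))
                             (p≤q⇒0≤q-p ρ≤1))
                   (p≤q⇒0≤q-p jensen)) ⟩
  ρ * (1ℚ - p) * (p * ρ * a + (1ℚ - p * ρ) * b)
    + (1ℚ - ρ) * ((p * ρ * m₁ + (1ℚ - p * ρ) * m₀) * (p * ρ * m₁ + (1ℚ - p * ρ) * m₀))
    ∎
  where open ≤-Reasoning

module _ {p ρ : ℚ} (0≤p : 0ℚ ≤ p) (p≤1 : p ≤ 1ℚ) (0≤ρ : 0ℚ ≤ ρ) (ρ≤1 : ρ ≤ 1ℚ) where

  private
    q = p * ρ

  Down-second-moment : ∀ n (F : Cube n → ℚ) →
    (1ℚ - q) * 𝔼 p n (λ x → Down ρ n F x * Down ρ n F x)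
      ≤ ρ * (1ℚ - p) * 𝔼 q n (λ y → F y * F y) + (1ℚ - ρ) * (𝔼 q n F * 𝔼 q n F)
  Down-second-moment zero F = ≤-reflexive (base p ρ (F []))
    where
    base : ∀ p ρ y → (1ℚ - p * ρ) * (1ℚ * ((1ℚ * y) * (1ℚ * y)))
                       ≡ ρ * (1ℚ - p) * (1ℚ * (y * y)) + (1ℚ - ρ) * ((1ℚ * y) * (1ℚ * y))
    base = solve-∀ ℚ-ring
  Down-second-moment (suc n) F = begin
    (1ℚ - q) * 𝔼 p (suc n) (λ x → Down ρ (suc n) F x * Down ρ (suc n) F x)
      ≡⟨ cong ((1ℚ - q) *_) split ⟩
    (1ℚ - q) * (p * sH + (1ℚ - p) * s₀)
      ≤⟨ second-moment-step 0≤p p≤1 ρ≤1 bound-H (Down-second-moment n F₀) jensen ⟩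
    ρ * (1ℚ - p) * (q * a + (1ℚ - q) * b) + (1ℚ - ρ) * ((q * m₁ + (1ℚ - q) * m₀) * (q * m₁ + (1ℚ - q) * m₀))
      ≡⟨ sym (cong₂ (λ s m → ρ * (1ℚ - p) * s + (1ℚ - ρ) * (m * m))
                    (𝔼-suc q n (λ y → F y * F y)) (𝔼-suc q n F)) ⟩
    ρ * (1ℚ - p) * 𝔼 q (suc n) (λ y → F y * F y) + (1ℚ - ρ) * (𝔼 q (suc n) F * 𝔼 q (suc n) F)
      ∎
    where
    open ≤-Reasoning
    F₁ F₀ H : Cube n → ℚ
    F₁ = F ∘ (true ∷_)
    F₀ = F ∘ (false ∷_)
    H = λ v → ρ * F₁ v + (1ℚ - ρ) * F₀ v
    sH s₀ a b c m₁ m₀ : ℚ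
    sH = 𝔼 p n (λ x → Down ρ n H x * Down ρ n H x)
    s₀ = 𝔼 p n (λ x → Down ρ n F₀ x * Down ρ n F₀ x)
    a = 𝔼 q n (λ y → F₁ y * F₁ y)
    b = 𝔼 q n (λ y → F₀ y * F₀ y)
    c = 𝔼 q n (λ y → F₁ y * F₀ y)
    m₁ = 𝔼 q n F₁
    m₀ = 𝔼 q n F₀
    split : 𝔼 p (suc n) (λ x → Down ρ (suc n) F x * Down ρ (suc n) F x) ≡ p * sH + (1ℚ - p) * s₀
    split = trans (𝔼-suc p n (λ x → Down ρ (suc n) F x * Down ρ (suc n) F x))
      (cong₂ (λ s t → p * s + (1ℚ - p) * t)
        (𝔼-cong p n (λ x → cong (λ e → e * e) (Down-true ρ n F x)))
        (𝔼-cong p n (λ x → cong (λ e → e * e) (Down-false ρ n F x))))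
    bound-H : (1ℚ - q) * sH
      ≤ ρ * (1ℚ - p) * (ρ * ρ * a + (ρ + ρ) * (1ℚ - ρ) * c + (1ℚ - ρ) * (1ℚ - ρ) * b)
        + (1ℚ - ρ) * ((ρ * m₁ + (1ℚ - ρ) * m₀) * (ρ * m₁ + (1ℚ - ρ) * m₀))
    bound-H = subst₂ (λ s m → (1ℚ - q) * sH ≤ ρ * (1ℚ - p) * s + (1ℚ - ρ) * (m * m))
      (𝔼-square-linear q n F₁ F₀ ρ (1ℚ - ρ)) (𝔼-linear q n ρ (1ℚ - ρ) F₁ F₀)
      (Down-second-moment n H)
    jensen : (m₁ - m₀) * (m₁ - m₀) ≤ a - (c + c) + b
    jensen = subst₂ (λ m s → m * m ≤ s) (𝔼-- q n F₁ F₀) (𝔼-square-difference q n F₁ F₀)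
      (𝔼-square-≤ (*-nonNeg 0≤p 0≤ρ) (*-mono-≤-nonNeg 0≤p p≤1 0≤ρ ρ≤1) n (λ y → F₁ y - F₀ y))

  Down-variance : ∀ n (F : Cube n → ℚ) →
    (1ℚ - q) * Var p n (Down ρ n F) ≤ ρ * (1ℚ - p) * Var q n F
  Down-variance n F = begin
    (1ℚ - q) * Var p n (Down ρ n F)
      ≡⟨ cong ((1ℚ - q) *_) (trans (Var-≡ p n (Down ρ n F))
                                   (cong (λ m → S - m * m) (𝔼-Down p ρ n F))) ⟩
    (1ℚ - q) * (S - m * m)
      ≡⟨ distribute q S m ⟩
    (1ℚ - q) * S - (1ℚ - q) * (m * m)
      ≤⟨ +-monoˡ-≤ (- ((1ℚ - q) * (m * m))) (Down-second-moment n F) ⟩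
    ρ * (1ℚ - p) * 𝔼 q n (λ y → F y * F y) + (1ℚ - ρ) * (m * m) - (1ℚ - p * ρ) * (m * m)
      ≡⟨ collect p ρ (𝔼 q n (λ y → F y * F y)) m ⟩
    ρ * (1ℚ - p) * (𝔼 q n (λ y → F y * F y) - m * m)
      ≡⟨ cong (ρ * (1ℚ - p) *_) (sym (Var-≡ q n F)) ⟩
    ρ * (1ℚ - p) * Var q n F
      ∎
    where
    open ≤-Reasoning
    S m : ℚ
    S = 𝔼 p n (λ x → Down ρ n F x * Down ρ n F x)
    m = 𝔼 q n F
    distribute : ∀ q S m → (1ℚ - q) * (S - m * m) ≡ (1ℚ - q) * S - (1ℚ - q) * (m * m)
    distribute = solve-∀ ℚ-ring
    collect : ∀ p ρ A m →
      ρ * (1ℚ - p) * A + (1ℚ - ρ) * (m * m) - (1ℚ - p * ρ) * (m * m) ≡ ρ * (1ℚ - p) * (A - m * m)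
    collect = solve-∀ ℚ-ring

Var-indicator-≤ : ∀ p n (g : Cube n → Bool) → Var p n (𝟙 ∘ g) ≤ 𝔼 p n (𝟙 ∘ g)
Var-indicator-≤ p n g = begin
  Var p n (𝟙 ∘ g)          ≡⟨ Var-≡ p n (𝟙 ∘ g) ⟩
  𝔼 p n (λ x → 𝟙 (g x) * 𝟙 (g x)) - m * m
                            ≡⟨ cong (_- m * m) (𝔼-cong p n (𝟙-idem ∘ g)) ⟩
  m - m * m                 ≤⟨ ≤-by-difference (m * m) (cancel m) (square-nonNeg m) ⟩
  m                         ∎
  where
  open ≤-Reasoning
  m = 𝔼 p n (𝟙 ∘ g)
  𝟙-idem : ∀ b → 𝟙 b * 𝟙 b ≡ 𝟙 b
  𝟙-idem true  = refl
  𝟙-idem false = refl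
  cancel : ∀ m → m - (m - m * m) ≡ m * m
  cancel = solve-∀ ℚ-ring

0≤½ : 0ℚ ≤ ½
0≤½ = nonNegative⁻¹ ½

½≤1 : ½ ≤ 1ℚ
½≤1 = toWitness {a? = ½ ≤? 1ℚ} tt

⅛ : ℚ
⅛ = ½ * ½ * ½

⅛⁴<½ : ⅛ * ⅛ * ⅛ * ⅛ < ½
⅛⁴<½ = toWitness {a? = ⅛ * ⅛ * ⅛ * ⅛ <? ½} tt

tail-from-variance : ∀ {ν ξ m V P} → 0ℚ < ν → ν ≤ ½ → 0ℚ ≤ ξ → 2 * ν ≤ m → 8 * ν ≤ ξ * m →
  (m - ν) * (m - ν) * (1ℚ - P) ≤ V → (1ℚ - ν) * V ≤ ν * m → 1ℚ - ξ ≤ P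
tail-from-variance {ν} {ξ} {m} {V} {P} 0<ν ν≤½ 0≤ξ 2ν≤m 8ν≤ξm chebyshev-bound variance-bound =
  ≤-by-difference (ξ - (1ℚ - P)) (solve (List ℚ ∋ ξ ∷ P ∷ []) ℚ-ring) (p≤q⇒0≤q-p 1-P≤ξ)
  where
  open ≤-Reasoning
  0≤ν : 0ℚ ≤ ν
  0≤ν = <⇒≤ 0<ν
  0≤m : 0ℚ ≤ m
  0≤m = ≤-trans (*-nonNeg (nonNegative⁻¹ 2) 0≤ν) 2ν≤m
  ½≤1-ν : ½ ≤ 1ℚ - ν
  ½≤1-ν = ≤-by-difference (½ - ν) (solve (List ℚ ∋ ν ∷ []) ℚ-ring) (p≤q⇒0≤q-p ν≤½)
  0≤1-ν : 0ℚ ≤ 1ℚ - ν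
  0≤1-ν = ≤-trans 0≤½ ½≤1-ν
  ½m≤m-ν : ½ * m ≤ m - ν
  ½m≤m-ν = ≤-by-difference (½ * (m - 2 * ν)) (solve (List ℚ ∋ ν ∷ m ∷ []) ℚ-ring)
             (*-nonNeg 0≤½ (p≤q⇒0≤q-p 2ν≤m))
  ν<m : ν < m
  ν<m = begin-strict
    ν        ≡⟨ sym (+-identityʳ ν) ⟩
    ν + 0ℚ   <⟨ +-monoʳ-< ν 0<ν ⟩
    ν + ν    ≡⟨ solve (List ℚ ∋ ν ∷ []) ℚ-ring ⟩
    2 * ν    ≤⟨ 2ν≤m ⟩
    m        ∎
  A : ℚ
  A = (1ℚ - ν) * ((m - ν) * (m - ν))
  0<A : 0ℚ < A
  0<A = *-pos (<-≤-trans (positive⁻¹ ½) ½≤1-ν) (*-pos (p<q⇒0<q-p ν<m) (p<q⇒0<q-p ν<m))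
  νm≤Aξ : ν * m ≤ A * ξ
  νm≤Aξ = begin
    ν * m                        ≡⟨ solve (List ℚ ∋ ν ∷ m ∷ []) ℚ-ring ⟩
    ⅛ * ((8 * ν) * m)            ≤⟨ *-monoˡ-≤-nonNeg ⅛ (*-monoʳ-≤-nonNeg m {{nonNegative 0≤m}} 8ν≤ξm) ⟩
    ⅛ * ((ξ * m) * m)            ≡⟨ solve (List ℚ ∋ ξ ∷ m ∷ []) ℚ-ring ⟩
    ½ * ((½ * m) * (½ * m)) * ξ  ≤⟨ *-monoʳ-≤-nonNeg ξ {{nonNegative 0≤ξ}}
                                      (*-mono-≤-nonNeg 0≤½ ½≤1-ν (square-nonNeg (½ * m))
                                        (*-mono-≤-nonNeg 0≤½m ½m≤m-ν 0≤½m ½m≤m-ν)) ⟩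
    A * ξ                        ∎
    where
    0≤½m : 0ℚ ≤ ½ * m
    0≤½m = *-nonNeg 0≤½ 0≤m
  1-P≤ξ : 1ℚ - P ≤ ξ
  1-P≤ξ = *-cancelˡ-≤-pos A {{positive 0<A}} (begin
    A * (1ℚ - P)                               ≡⟨ *-assoc (1ℚ - ν) ((m - ν) * (m - ν)) (1ℚ - P) ⟩
    (1ℚ - ν) * ((m - ν) * (m - ν) * (1ℚ - P))  ≤⟨ *-monoˡ-≤-nonNeg (1ℚ - ν) {{nonNegative 0≤1-ν}} chebyshev-bound ⟩
    (1ℚ - ν) * V                               ≤⟨ variance-bound ⟩
    ν * m                                      ≤⟨ νm≤Aξ ⟩
    A * ξ                                      ∎)

T↑-lower-tail : ∀ {ν ξ} → 0ℚ < ν → ν ≤ ½ → 0ℚ ≤ ξ → ∀ n (g : Cube n → Bool) →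
  2 * ν ≤ 𝔼 ν n (𝟙 ∘ g) → 8 * ν ≤ ξ * 𝔼 ν n (𝟙 ∘ g) →
  1ℚ - ξ ≤ Pr ½ n (λ x → ν ≤ᵇ T↑ ν n g x)
T↑-lower-tail {ν} 0<ν ν≤½ 0≤ξ n g 2ν≤m 8ν≤ξm =
  tail-from-variance 0<ν ν≤½ 0≤ξ 2ν≤m 8ν≤ξm chebyshev-bound variance-bound
  where
  open ≤-Reasoning
  m : ℚ
  m = 𝔼 ν n (𝟙 ∘ g)
  f : Cube n → ℚ
  f = T↑ ν n g
  0≤ν : 0ℚ ≤ ν
  0≤ν = <⇒≤ 0<ν
  half-double : ½ * (ν + ν) ≡ ν
  half-double = solve (List ℚ ∋ ν ∷ []) ℚ-ring
  double-half : (ν + ν) * (1ℚ - ½) ≡ ν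
  double-half = solve (List ℚ ∋ ν ∷ []) ℚ-ring
  mean : 𝔼 ½ n f ≡ m
  mean = trans (𝔼-Down ½ (ν + ν) n (𝟙 ∘ g)) (cong (λ q → 𝔼 q n (𝟙 ∘ g)) half-double)
  ν≤m : ν ≤ m
  ν≤m = ≤-trans ν≤2ν 2ν≤m
    where
    ν≤2ν : ν ≤ 2 * ν
    ν≤2ν = ≤-by-difference ν (solve (List ℚ ∋ ν ∷ []) ℚ-ring) 0≤ν
  chebyshev-bound : (m - ν) * (m - ν) * (1ℚ - Pr ½ n (λ x → ν ≤ᵇ f x)) ≤ Var ½ n f
  chebyshev-bound = subst (λ m → (m - ν) * (m - ν) * (1ℚ - Pr ½ n (λ x → ν ≤ᵇ f x)) ≤ Var ½ n f) mean
    (chebyshev 0≤½ ½≤1 n f (subst (ν ≤_) (sym mean) ν≤m))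
  variance-bound : (1ℚ - ν) * Var ½ n f ≤ ν * m
  variance-bound = begin
    (1ℚ - ν) * Var ½ n f
      ≡⟨ cong (λ q → (1ℚ - q) * Var ½ n f) (sym half-double) ⟩
    (1ℚ - ½ * (ν + ν)) * Var ½ n f
      ≤⟨ Down-variance 0≤½ ½≤1 (+-nonNeg 0≤ν 0≤ν) (+-mono-≤ ν≤½ ν≤½) n (𝟙 ∘ g) ⟩
    (ν + ν) * (1ℚ - ½) * Var (½ * (ν + ν)) n (𝟙 ∘ g)
      ≡⟨ cong₂ (λ r q → r * Var q n (𝟙 ∘ g)) double-half half-double ⟩
    ν * Var ν n (𝟙 ∘ g)
      ≤⟨ *-monoˡ-≤-nonNeg ν {{nonNegative 0≤ν}} (Var-indicator-≤ ν n g) ⟩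
    ν * m
      ∎

-- For ν = t⁴ the hypothesis γ ν^{3/4} ≤ m reads γ t³ ≤ m.
fourth-power-bias : ∀ {γ ξ t m} → 0ℚ ≤ t → 0ℚ ≤ ξ → 8 * t ≤ γ → 8 * t ≤ ξ * γ →
  AtLeastγν¾ γ (t * t * t * t) m → 2 * (t * t * t * t) ≤ m × 8 * (t * t * t * t) ≤ ξ * m
fourth-power-bias {γ} {ξ} {t} {m} 0≤t 0≤ξ 8t≤γ 8t≤ξγ (0≤m , γ⁴ν³≤m⁴) = 2ν≤m , 8ν≤ξm
  where
  open ≤-Reasoning
  0≤t³ : 0ℚ ≤ t * t * t
  0≤t³ = *-nonNeg (*-nonNeg 0≤t 0≤t) 0≤t
  γt³≤m : γ * (t * t * t) ≤ m
  γt³≤m = ⁴-cancel-≤ 0≤m (begin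
    γ * (t * t * t) * (γ * (t * t * t)) * (γ * (t * t * t)) * (γ * (t * t * t))
      ≡⟨ solve (List ℚ ∋ γ ∷ t ∷ []) ℚ-ring ⟩
    γ * γ * γ * γ * ((t * t * t * t) * (t * t * t * t) * (t * t * t * t))
      ≤⟨ γ⁴ν³≤m⁴ ⟩
    m * m * m * m
      ∎)
  2t≤γ : 2 * t ≤ γ
  2t≤γ = ≤-trans 2t≤8t 8t≤γ
    where
    2t≤8t : 2 * t ≤ 8 * t
    2t≤8t = ≤-by-difference (6 * t) (solve (List ℚ ∋ t ∷ []) ℚ-ring) (*-nonNeg (nonNegative⁻¹ 6) 0≤t)
  2ν≤m : 2 * (t * t * t * t) ≤ m
  2ν≤m = begin
    2 * (t * t * t * t)  ≡⟨ solve (List ℚ ∋ t ∷ []) ℚ-ring ⟩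
    t * t * t * (2 * t)  ≤⟨ *-monoˡ-≤-nonNeg (t * t * t) {{nonNegative 0≤t³}} 2t≤γ ⟩
    t * t * t * γ        ≡⟨ *-comm (t * t * t) γ ⟩
    γ * (t * t * t)      ≤⟨ γt³≤m ⟩
    m                    ∎
  8ν≤ξm : 8 * (t * t * t * t) ≤ ξ * m
  8ν≤ξm = begin
    8 * (t * t * t * t)    ≡⟨ solve (List ℚ ∋ t ∷ []) ℚ-ring ⟩
    t * t * t * (8 * t)    ≤⟨ *-monoˡ-≤-nonNeg (t * t * t) {{nonNegative 0≤t³}} 8t≤ξγ ⟩
    t * t * t * (ξ * γ)    ≡⟨ solve (List ℚ ∋ ξ ∷ γ ∷ t ∷ []) ℚ-ring ⟩
    ξ * (γ * (t * t * t))  ≤⟨ *-monoˡ-≤-nonNeg ξ {{nonNegative 0≤ξ}} γt³≤m ⟩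
    ξ * m                  ∎

⊓-pos : ∀ {p q} → 0ℚ < p → 0ℚ < q → 0ℚ < p ℚ.⊓ q
⊓-pos {p} {q} 0<p 0<q with ⊓-sel p q
... | inj₁ p⊓q≡p = subst (0ℚ <_) (sym p⊓q≡p) 0<p
... | inj₂ p⊓q≡q = subst (0ℚ <_) (sym p⊓q≡q) 0<q

bias-choice : ∀ {γ ξ} → 0ℚ < γ → 0ℚ < ξ →
  Σ ℚ λ ν → 0ℚ < ν × ν < ½ × (∀ {m} → AtLeastγν¾ γ ν m → 2 * ν ≤ m × 8 * ν ≤ ξ * m)
bias-choice {γ} {ξ} 0<γ 0<ξ =
  t * t * t * t , 0<ν , ν<½ , fourth-power-bias (<⇒≤ 0<t) (<⇒≤ 0<ξ) 8t≤γ 8t≤ξγ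
  where
  a b t : ℚ
  a = ξ ℚ.⊓ 1ℚ
  b = γ ℚ.⊓ 1ℚ
  t = ⅛ * (a * b)
  0<a : 0ℚ < a
  0<a = ⊓-pos 0<ξ (positive⁻¹ 1ℚ)
  0<b : 0ℚ < b
  0<b = ⊓-pos 0<γ (positive⁻¹ 1ℚ)
  0≤a : 0ℚ ≤ a
  0≤a = <⇒≤ 0<a
  0≤b : 0ℚ ≤ b
  0≤b = <⇒≤ 0<b
  0<t : 0ℚ < t
  0<t = *-pos (positive⁻¹ ⅛) (*-pos 0<a 0<b)
  8t≡ab : 8 * t ≡ a * b
  8t≡ab = eight-eighths (a * b)
    where
    eight-eighths : ∀ x → 8 * (⅛ * x) ≡ x
    eight-eighths = solve-∀ ℚ-ring
  8t≤γ : 8 * t ≤ γ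
  8t≤γ = subst (_≤ γ) (sym 8t≡ab)
    (≤-trans (*-mono-≤-nonNeg 0≤a (p⊓q≤q ξ 1ℚ) 0≤b (p⊓q≤p γ 1ℚ)) (≤-reflexive (*-identityˡ γ)))
  8t≤ξγ : 8 * t ≤ ξ * γ
  8t≤ξγ = subst (_≤ ξ * γ) (sym 8t≡ab) (*-mono-≤-nonNeg 0≤a (p⊓q≤p ξ 1ℚ) 0≤b (p⊓q≤p γ 1ℚ))
  t≤⅛ : t ≤ ⅛
  t≤⅛ = *-monoˡ-≤-nonNeg ⅛ (*-mono-≤-nonNeg 0≤a (p⊓q≤q ξ 1ℚ) 0≤b (p⊓q≤q γ 1ℚ))
  0<ν : 0ℚ < t * t * t * t
  0<ν = *-pos (*-pos (*-pos 0<t 0<t) 0<t) 0<t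
  ν<½ : t * t * t * t < ½
  ν<½ = ≤-<-trans (⁴-mono-≤ (<⇒≤ 0<t) t≤⅛) ⅛⁴<½

lemma6p7 : (γ ξ : ℚ) → 0ℚ < γ → 0ℚ < ξ →
    Σ ℚ (λ ν → (0ℚ < ν) × (ν < ½) ×
      ((n : ℕ) → (g : Cube n → Bool) →
        AtLeastγν¾ γ ν (𝔼 ν n (λ y → 𝟙 (g y))) →
        1ℚ - ξ ≤ Pr ½ n (λ x → ν ≤ᵇ T↑ ν n g x)))
lemma6p7 γ ξ 0<γ 0<ξ =
  let ν , 0<ν , ν<½ , small-relative-to-mean = bias-choice 0<γ 0<ξ
  in ν , 0<ν , ν<½ , λ n g γν¾≤𝔼g →
       let 2ν≤𝔼g , 8ν≤ξ𝔼g = small-relative-to-mean γν¾≤𝔼g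
       in T↑-lower-tail 0<ν (<⇒≤ ν<½) (<⇒≤ 0<ξ) n g 2ν≤𝔼g 8ν≤ξ𝔼g
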